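{- Let $n \ge 3$ be a prime such that there exists an exponential orthomorphism modulo $n$. Then $n = 3$.
   Context: For an integer $n \ge 2$, an exponential orthomorphism modulo $n$ is a permutation $\sigma$ of $\{1, \dots, n-1\}$ such that the map $x \mapsto x^{\sigma(x)} \bmod n$ is also a bijection of $\{1, \dots, n-1\}$. -}

module Defs where

open import Data.Nat using (ℕ; zero; suc; _+_; _∸_; _^_; _%_; NonZero)
open import Data.Fin using (Fin; toℕ)
open import Data.Product using (Σ; _×_)
open import Function.Bundles using (Bijection)
open import Function.Definitions using (Bijective)
open import Relation.Binary.PropositionalEquality using (_≡_)

-- The set {1, …, n-1} is encoded as Fin (n ∸ 1), with i : Fin (n ∸ 1)
-- standing for the integer toℕ i + 1.
elt : {n : ℕ} → Fin (n ∸ 1) → ℕ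
elt i = toℕ i + 1

-- An exponential orthomorphism modulo n: a permutation σ of {1,…,n-1}
-- (a bijective map Fin (n ∸ 1) → Fin (n ∸ 1)) such that the map
-- x ↦ x ^ σ(x) mod n is a bijection of {1,…,n-1}; the latter is expressed
-- as: there is a bijective τ on Fin (n ∸ 1) with elt (τ x) ≡ x^σ(x) mod n
-- for all x (in particular the value lies in {1,…,n-1}).
ExpOrthomorphism : (n : ℕ) → .{{_ : NonZero n}} → Set
ExpOrthomorphism n =
  Σ (Fin (n ∸ 1) → Fin (n ∸ 1)) λ σ →
    Bijective _≡_ _≡_ σ ×
    Σ (Fin (n ∸ 1) → Fin (n ∸ 1)) λ τ →
      Bijective _≡_ _≡_ τ ×
      ((x : Fin (n ∸ 1)) → elt {n} (τ x) ≡ (elt {n} x ^ elt {n} (σ x)) % n)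

module Submission where

-- Let p = N + 1 ≥ 5 be prime, σ a permutation of {1, …, N} and τ the
-- permutation x ↦ x ^ σ x mod p.  Since 1 ^ e = 1 and x ^ N ≡ 1
-- (Fermat), τ 1 = 1 forces σ 1 = N.  Write N = q d with q prime and
-- q ≥ 3 or q ∣ d.  The q elements y j = σ⁻¹ (j d), 1 ≤ j ≤ q, have
-- τ (y j) ^ q ≡ 1, so the τ (y j) are all the q-th roots of unity modulo p
-- (Lagrange).  ζ = τ (y 1) has order q, and for 1 ≤ i < q the root ζ ^ i
-- equals y (J i) with J i < q; then τ (ζ ^ i) = ζ ^ (H i) with
-- H i ≡ i · J i · d (mod q), and J, H are injections of {1, …, q - 1}.
-- Multiplying over i gives (q-1)! · (q-1)! · d ^ (q-1) ≡ (q-1)! (mod q),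
-- which contradicts Fermat and Wilson when q ≥ 3; when q ∣ d already
-- H i ≡ 0 is impossible.

open import Defs
open import Data.Nat using (ℕ; _≤_; NonZero)
open import Data.Nat.Primality using (Prime)
open import Relation.Binary.PropositionalEquality using (_≡_)

open import Data.Nat.Base
open import Data.Nat.Properties
open import Data.Nat.DivMod
open import Data.Nat.Divisibility
open import Data.Nat.Primality
open import Data.Nat.Primality.Factorisation using (factorise)
open import Data.List.Base using ([]; _∷_)
open import Data.List.Relation.Unary.All using (_∷_)
open import Data.Nat.GCD using (module GCD; module Bézout)
open import Data.Vec.Base using (Vec; []; _∷_)
open import Data.Fin.Base using (Fin; toℕ; fromℕ<; punchOut)
import Data.Fin.Base as F
import Data.Fin.Properties as FP
open import Data.Fin.Permutation using (Permutation′; permutation)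
open import Data.Product
open import Data.Sum using (_⊎_; inj₁; inj₂; [_,_]′)
open import Data.Empty
open import Function.Base using (_∘_; id)
open import Function.Definitions using (Injective; Surjective)
open import Relation.Nullary
open import Relation.Nullary.Decidable using (map′)
open import Relation.Binary.PropositionalEquality hiding (J)
open import Algebra.Properties.CommutativeMonoid.Sum *-1-commutativeMonoid
  using (sum-permute; sum-cong-≗; sum-init-last; ∑-distrib-+)
  renaming (sum to prod)
open import Data.Nat.Solver using (module +-*-Solver)
open import Relation.Binary.Definitions using (tri<; tri≈; tri>)
open import Relation.Binary.Bundles using (Setoid)
open import Relation.Binary.Structures using (IsEquivalence)
import Relation.Binary.Reasoning.Setoid as SetoidReasoning
open import Level using (0ℓ)

prime≥2 : ∀ {p} → Prime p → 2 ≤ p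
prime≥2 {p} pr = nonTrivial⇒n>1 p {{prime⇒nonTrivial pr}}

module Congruence (m : ℕ) .{{_ : NonZero m}} where

  infix 4 _≡ₘ_

  -- a ≡ₘ b : a and b have the same residue modulo m.  (A record rather
  -- than a plain equation of residues, so that a and b stay visible to
  -- the type checker.)
  record _≡ₘ_ (a b : ℕ) : Set where
    constructor %≡⇒≡ₘ
    field ≡ₘ⇒%≡ : a % m ≡ b % m
  open _≡ₘ_ public

  ≡⇒≡ₘ : ∀ {a b} → a ≡ b → a ≡ₘ b
  ≡⇒≡ₘ a≡b = %≡⇒≡ₘ (cong (_% m) a≡b)

  ≡ₘ-isEquivalence : IsEquivalence _≡ₘ_
  ≡ₘ-isEquivalence = record
    { refl  = %≡⇒≡ₘ refl
    ; sym   = λ (%≡⇒≡ₘ a≡b) → %≡⇒≡ₘ (sym a≡b)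
    ; trans = λ (%≡⇒≡ₘ a≡b) (%≡⇒≡ₘ b≡c) → %≡⇒≡ₘ (trans a≡b b≡c)
    }

  ≡ₘ-setoid : Setoid 0ℓ 0ℓ
  ≡ₘ-setoid = record { isEquivalence = ≡ₘ-isEquivalence }

  open IsEquivalence ≡ₘ-isEquivalence public
    using () renaming (refl to ≡ₘ-refl; sym to ≡ₘ-sym; trans to ≡ₘ-trans)

  module ≡ₘ-Reasoning = SetoidReasoning ≡ₘ-setoid

  _≡ₘ?_ : ∀ a b → Dec (a ≡ₘ b)
  a ≡ₘ? b = map′ %≡⇒≡ₘ ≡ₘ⇒%≡ (a % m ≟ b % m)

  %-≡ₘ : ∀ a → a % m ≡ₘ a
  %-≡ₘ a = %≡⇒≡ₘ (m%n%n≡m%n a m)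

  <⇒≡ₘ⇒≡ : ∀ {a b} → a < m → b < m → a ≡ₘ b → a ≡ b
  <⇒≡ₘ⇒≡ {a} {b} a<m b<m (%≡⇒≡ₘ a≡b) = begin
    a       ≡⟨ m<n⇒m%n≡m a<m ⟨
    a % m   ≡⟨ a≡b ⟩
    b % m   ≡⟨ m<n⇒m%n≡m b<m ⟩
    b       ∎
    where open ≡-Reasoning

  *-congₘ : ∀ {a b c d} → a ≡ₘ b → c ≡ₘ d → a * c ≡ₘ b * d
  *-congₘ {a} {b} {c} {d} (%≡⇒≡ₘ a≡b) (%≡⇒≡ₘ c≡d) = %≡⇒≡ₘ (begin
    (a * c) % m             ≡⟨ %-distribˡ-* a c m ⟩
    (a % m * (c % m)) % m   ≡⟨ cong₂ (λ x y → (x * y) % m) a≡b c≡d ⟩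
    (b % m * (d % m)) % m   ≡⟨ %-distribˡ-* b d m ⟨
    (b * d) % m             ∎)
    where open ≡-Reasoning

  +-congₘ : ∀ {a b c d} → a ≡ₘ b → c ≡ₘ d → a + c ≡ₘ b + d
  +-congₘ {a} {b} {c} {d} (%≡⇒≡ₘ a≡b) (%≡⇒≡ₘ c≡d) = %≡⇒≡ₘ (begin
    (a + c) % m             ≡⟨ %-distribˡ-+ a c m ⟩
    (a % m + c % m) % m     ≡⟨ cong₂ (λ x y → (x + y) % m) a≡b c≡d ⟩
    (b % m + d % m) % m     ≡⟨ %-distribˡ-+ b d m ⟨
    (b + d) % m             ∎)
    where open ≡-Reasoning

  ^-congₘ : ∀ {a b} k → a ≡ₘ b → a ^ k ≡ₘ b ^ k
  ^-congₘ zero    a≡b = ≡ₘ-refl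
  ^-congₘ (suc k) a≡b = *-congₘ a≡b (^-congₘ k a≡b)

  prod-congₘ : ∀ {n} {G H : Fin n → ℕ} → (∀ i → G i ≡ₘ H i) → prod G ≡ₘ prod H
  prod-congₘ {zero}  G≡H = ≡ₘ-refl
  prod-congₘ {suc n} G≡H = *-congₘ (G≡H F.zero) (prod-congₘ (G≡H ∘ F.suc))

  ≡ₘ⇒∣∸ : ∀ {x y} → x ≡ₘ y → m ∣ x ∸ y
  ≡ₘ⇒∣∸ {x} {y} (%≡⇒≡ₘ x≡y) = divides (x / m ∸ y / m) (begin
    x ∸ y                                      ≡⟨ cong₂ _∸_ (m≡m%n+[m/n]*n x m) (m≡m%n+[m/n]*n y m) ⟩
    (x % m + x / m * m) ∸ (y % m + y / m * m)  ≡⟨ cong (λ r → (r + x / m * m) ∸ (y % m + y / m * m)) x≡y ⟩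
    (y % m + x / m * m) ∸ (y % m + y / m * m)  ≡⟨ [m+n]∸[m+o]≡n∸o (y % m) _ _ ⟩
    x / m * m ∸ y / m * m                      ≡⟨ *-distribʳ-∸ m (x / m) (y / m) ⟨
    (x / m ∸ y / m) * m                        ∎)
    where open ≡-Reasoning

  ∣∸⇒≡ₘ : ∀ {x y} → y ≤ x → m ∣ x ∸ y → x ≡ₘ y
  ∣∸⇒≡ₘ {x} {y} y≤x (divides k x∸y≡km) = %≡⇒≡ₘ (begin
    x % m                ≡⟨ cong (_% m) (m+[n∸m]≡n y≤x) ⟨
    (y + (x ∸ y)) % m    ≡⟨ cong (λ z → (y + z) % m) x∸y≡km ⟩
    (y + k * m) % m      ≡⟨ [m+kn]%n≡m%n y k m ⟩
    y % m                ∎)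
    where open ≡-Reasoning

  ∣⇒≡ₘ0 : ∀ {a} → m ∣ a → a ≡ₘ 0
  ∣⇒≡ₘ0 {a} m∣a = %≡⇒≡ₘ (trans (n∣m⇒m%n≡0 a m m∣a) (sym (m<n⇒m%n≡m (>-nonZero⁻¹ m))))

  +-cancelˡₘ : ∀ {x x′ y y′} → x ≡ₘ x′ → x + y ≡ₘ x′ + y′ → y ≡ₘ y′
  +-cancelˡₘ {x} {x′} {y} {y′} x≡x′ sum≡ with ≤-total y y′
  ... | inj₁ y≤y′ = ≡ₘ-sym (∣∸⇒≡ₘ y≤y′ (subst (m ∣_) ([m+n]∸[m+o]≡n∸o x′ y′ y) (≡ₘ⇒∣∸ (≡ₘ-sym sum≡′))))
    where sum≡′ : x′ + y ≡ₘ x′ + y′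
          sum≡′ = ≡ₘ-trans (+-congₘ (≡ₘ-sym x≡x′) ≡ₘ-refl) sum≡
  ... | inj₂ y′≤y = ∣∸⇒≡ₘ y′≤y (subst (m ∣_) ([m+n]∸[m+o]≡n∸o x′ y y′) (≡ₘ⇒∣∸ sum≡′))
    where sum≡′ : x′ + y ≡ₘ x′ + y′
          sum≡′ = ≡ₘ-trans (+-congₘ (≡ₘ-sym x≡x′) ≡ₘ-refl) sum≡

  ^-*-≡ₘ1 : ∀ {z} k y → z ^ k ≡ₘ 1 → z ^ (y * k) ≡ₘ 1
  ^-*-≡ₘ1 {z} k y zᵏ≡1 = begin
    z ^ (y * k)    ≡⟨ cong (z ^_) (*-comm y k) ⟩
    z ^ (k * y)    ≡⟨ ^-*-assoc z k y ⟨
    (z ^ k) ^ y    ≈⟨ ^-congₘ y zᵏ≡1 ⟩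
    1 ^ y          ≡⟨ ^-zeroˡ y ⟩
    1              ∎
    where open ≡ₘ-Reasoning

  ^-+-≡ₘ1 : ∀ z a b → z ^ b ≡ₘ 1 → z ^ (a + b) ≡ₘ z ^ a
  ^-+-≡ₘ1 z a b zᵇ≡1 = begin
    z ^ (a + b)      ≡⟨ ^-distribˡ-+-* z a b ⟩
    z ^ a * z ^ b    ≈⟨ *-congₘ (≡ₘ-refl {z ^ a}) zᵇ≡1 ⟩
    z ^ a * 1        ≡⟨ *-identityʳ (z ^ a) ⟩
    z ^ a            ∎
    where open ≡ₘ-Reasoning

  ^-%-≡ₘ : ∀ z k .{{_ : NonZero k}} e → z ^ k ≡ₘ 1 → z ^ e ≡ₘ z ^ (e % k)
  ^-%-≡ₘ z k e zᵏ≡1 = begin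
    z ^ e                   ≡⟨ cong (z ^_) (m≡m%n+[m/n]*n e k) ⟩
    z ^ (e % k + e / k * k) ≈⟨ ^-+-≡ₘ1 z (e % k) (e / k * k) (^-*-≡ₘ1 k (e / k) zᵏ≡1) ⟩
    z ^ (e % k)             ∎
    where open ≡ₘ-Reasoning

  ^-Bézout-≡ₘ1 : ∀ z {u v} x y → z ^ u ≡ₘ 1 → z ^ v ≡ₘ 1 → 1 + y * u ≡ x * v → z ≡ₘ 1
  ^-Bézout-≡ₘ1 z {u} {v} x y zᵘ≡1 zᵛ≡1 1+yu≡xv = begin
    z                ≡⟨ *-identityʳ z ⟨
    z ^ 1            ≈⟨ ^-+-≡ₘ1 z 1 (y * u) (^-*-≡ₘ1 u y zᵘ≡1) ⟨
    z ^ (1 + y * u)  ≡⟨ cong (z ^_) 1+yu≡xv ⟩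
    z ^ (x * v)      ≈⟨ ^-*-≡ₘ1 v x zᵛ≡1 ⟩
    1                ∎
    where open ≡ₘ-Reasoning

  -- If z ^ q ≡ 1 for a prime q and z ^ k ≡ 1 for some 0 < k < q, then
  -- z ≡ 1, since gcd (k, q) = 1 is a Bézout combination of k and q.
  prime-order : ∀ {z q k} → Prime q → z ^ q ≡ₘ 1 → z ^ k ≡ₘ 1 → 0 < k → k < q → z ≡ₘ 1
  prime-order {z} {q} {k} q-prime z^q≡1 z^k≡1 0<k k<q with Bézout.lemma k q
  ... | Bézout.result g gcd identity with prime⇒irreducible q-prime (GCD.gcd∣n gcd)
  ...   | inj₂ refl = ⊥-elim (<⇒≱ k<q (∣⇒≤ {{>-nonZero 0<k}} (GCD.gcd∣m gcd)))
  ...   | inj₁ refl with identity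
  ...     | Bézout.+- x y eq = ^-Bézout-≡ₘ1 z x y z^q≡1 z^k≡1 eq
  ...     | Bézout.-+ x y eq = ^-Bézout-≡ₘ1 z y x z^k≡1 z^q≡1 eq

  module _ (pr : Prime m) where

    ¬∣1 : ¬ m ∣ 1
    ¬∣1 m∣1 = nonTrivial⇒≢1 {{prime⇒nonTrivial pr}} (∣1⇒≡1 m∣1)

    ¬∣* : ∀ {a b} → ¬ m ∣ a → ¬ m ∣ b → ¬ m ∣ a * b
    ¬∣* m∤a m∤b m∣ab = [ m∤a , m∤b ]′ (euclidsLemma _ _ pr m∣ab)

    ¬∣^ : ∀ {a} k → ¬ m ∣ a → ¬ m ∣ a ^ k
    ¬∣^ zero    m∤a = ¬∣1
    ¬∣^ (suc k) m∤a = ¬∣* m∤a (¬∣^ k m∤a)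

    prod-¬∣ : ∀ {n} (G : Fin n → ℕ) → (∀ i → ¬ m ∣ G i) → ¬ m ∣ prod G
    prod-¬∣ {zero}  G m∤G = ¬∣1
    prod-¬∣ {suc n} G m∤G = ¬∣* (m∤G F.zero) (prod-¬∣ (G ∘ F.suc) (m∤G ∘ F.suc))

    ∣*¬∣⇒∣ : ∀ {c d} → ¬ m ∣ c → m ∣ d * c → m ∣ d
    ∣*¬∣⇒∣ m∤c m∣dc = [ id , (λ m∣c → ⊥-elim (m∤c m∣c)) ]′ (euclidsLemma _ _ pr m∣dc)

    *-cancelʳₘ : ∀ {a b c} → ¬ m ∣ c → a * c ≡ₘ b * c → a ≡ₘ b
    *-cancelʳₘ {a} {b} {c} m∤c ac≡bc with ≤-total b a
    ... | inj₁ b≤a =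
      ∣∸⇒≡ₘ b≤a (∣*¬∣⇒∣ m∤c (subst (m ∣_) (sym (*-distribʳ-∸ c a b)) (≡ₘ⇒∣∸ ac≡bc)))
    ... | inj₂ a≤b =
      ≡ₘ-sym (∣∸⇒≡ₘ a≤b (∣*¬∣⇒∣ m∤c (subst (m ∣_) (sym (*-distribʳ-∸ c b a)) (≡ₘ⇒∣∸ (≡ₘ-sym ac≡bc)))))

    *-cancelʳ-≢ₘ : ∀ {a b c} → ¬ a ≡ₘ b → a * c ≡ₘ b * c → m ∣ c
    *-cancelʳ-≢ₘ {c = c} a≢b ac≡bc with m ∣? c
    ... | yes m∣c = m∣c
    ... | no  m∤c = ⊥-elim (a≢b (*-cancelʳₘ m∤c ac≡bc))

    module PrimeOrder {q ζ} (q-prime : Prime q) (m∤ζ : ¬ m ∣ ζ) (ζ^q≡1 : ζ ^ q ≡ₘ 1) (ζ≢1 : ¬ ζ ≡ₘ 1) where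

      ζ^k≢1 : ∀ {k} → 0 < k → k < q → ¬ ζ ^ k ≡ₘ 1
      ζ^k≢1 0<k k<q ζ^k≡1 = ζ≢1 (prime-order q-prime ζ^q≡1 ζ^k≡1 0<k k<q)

      -- ζ ^ b ≡ ζ ^ a with a < b would give ζ ^ (b - a) ≡ 1.
      ζ^-distinct : ∀ {a b} → a < b → b < q → ¬ ζ ^ b ≡ₘ ζ ^ a
      ζ^-distinct {a} {b} a<b b<q ζ^b≡ζ^a =
        ζ^k≢1 (m<n⇒0<n∸m a<b) (≤-<-trans (m∸n≤m b a) b<q) (*-cancelʳₘ (¬∣^ a m∤ζ) (begin
          ζ ^ (b ∸ a) * ζ ^ a  ≡⟨ ^-distribˡ-+-* ζ (b ∸ a) a ⟨
          ζ ^ (b ∸ a + a)      ≡⟨ cong (ζ ^_) (m∸n+n≡m (<⇒≤ a<b)) ⟩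
          ζ ^ b                ≈⟨ ζ^b≡ζ^a ⟩
          ζ ^ a                ≡⟨ *-identityˡ (ζ ^ a) ⟨
          1 * ζ ^ a            ∎))
        where open ≡ₘ-Reasoning

      ζ^-injective : ∀ {a b} → a < q → b < q → ζ ^ a ≡ₘ ζ ^ b → a ≡ b
      ζ^-injective {a} {b} a<q b<q ζ^a≡ζ^b with <-cmp a b
      ... | tri< a<b _ _ = ⊥-elim (ζ^-distinct a<b b<q (≡ₘ-sym ζ^a≡ζ^b))
      ... | tri≈ _ a≡b _ = a≡b
      ... | tri> _ _ b<a = ⊥-elim (ζ^-distinct b<a a<q ζ^a≡ζ^b)

-- The set {1, …, M} as Fin M

val : ∀ {M} → Fin M → ℕ
val i = suc (toℕ i)

val≡elt : ∀ {M} (i : Fin M) → val i ≡ elt {suc M} i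
val≡elt i = +-comm 1 (toℕ i)

1≤val : ∀ {M} (i : Fin M) → 1 ≤ val i
1≤val i = s≤s z≤n

val≤ : ∀ {M} (i : Fin M) → val i ≤ M
val≤ i = FP.toℕ<n i

val-injective : ∀ {M} → Injective _≡_ _≡_ (val {M})
val-injective = FP.toℕ-injective ∘ suc-injective

fin : ∀ {M} v → 1 ≤ v → v ≤ M → Fin M
fin (suc v) _ v<M = fromℕ< v<M

val-fin : ∀ {M} v (1≤v : 1 ≤ v) (v≤M : v ≤ M) → val (fin v 1≤v v≤M) ≡ v
val-fin (suc v) _ v<M = cong suc (FP.toℕ-fromℕ< v<M)

last : ∀ {K} → Fin (suc K)
last {K} = F.fromℕ K

val-last : ∀ {K} → val (last {K}) ≡ suc K
val-last {K} = cong suc (FP.toℕ-fromℕ K)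

¬∣val : ∀ {M} (i : Fin M) → ¬ suc M ∣ val i
¬∣val i = >⇒∤ (s≤s (val≤ i))

residue : ∀ {M} a → ¬ suc M ∣ a → Fin M
residue {M} a r∤a = fin (a % suc M) (n≢0⇒n>0 (r∤a ∘ m%n≡0⇒n∣m a (suc M))) (s≤s⁻¹ (m%n<n a (suc M)))

val-residue : ∀ {M} a (r∤a : ¬ suc M ∣ a) → val (residue a r∤a) ≡ a % suc M
val-residue {M} a r∤a = val-fin (a % suc M) _ _

module _ {M : ℕ} where
  open Congruence (suc M)

  residue-≡ₘ : ∀ a (r∤a : ¬ suc M ∣ a) → val (residue a r∤a) ≡ₘ a
  residue-≡ₘ a r∤a = ≡ₘ-trans (≡⇒≡ₘ (val-residue a r∤a)) (%-≡ₘ a)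

-- Finite products

-- An injective endomap of a finite set is onto: otherwise it would
-- inject Fin n into Fin (n - 1).
injective⇒surjective : ∀ {n} (f : Fin n → Fin n) → Injective _≡_ _≡_ f → ∀ y → ∃ λ x → f x ≡ y
injective⇒surjective {n} f f-inj y with FP.any? (λ x → f x FP.≟ y)
... | yes hit = hit
injective⇒surjective {suc n} f f-inj y | no miss =
  ⊥-elim (<⇒≱ (n<1+n n) (FP.injective⇒≤ {f = g} g-inj))
  where
  y≢f : ∀ x → y ≢ f x
  y≢f x y≡fx = miss (x , sym y≡fx)
  g : Fin (suc n) → Fin n
  g x = punchOut (y≢f x)
  g-inj : Injective _≡_ _≡_ g
  g-inj gx≡gx′ = f-inj (FP.punchOut-injective (y≢f _) (y≢f _) gx≡gx′)

prod-reindex : ∀ {n} (G : Fin n → ℕ) (f : Fin n → Fin n) → Injective _≡_ _≡_ f → prod (G ∘ f) ≡ prod G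
prod-reindex {n} G f f-inj = sym (sum-permute G π)
  where
  f⁻¹ : Fin n → Fin n
  f⁻¹ y = proj₁ (injective⇒surjective f f-inj y)
  π : Permutation′ n
  π = permutation f f⁻¹ (proj₂ ∘ injective⇒surjective f f-inj) (f-inj ∘ proj₂ ∘ injective⇒surjective f f-inj ∘ f)

prod-const : ∀ {n} c → prod {n} (λ _ → c) ≡ c ^ n
prod-const {zero}  c = refl
prod-const {suc n} c = cong (c *_) (prod-const {n} c)

-- Fermat's little theorem for the prime r = M + 1: multiplication by a
-- unit a permutes {1, …, M}, so a ^ M · M! ≡ M! and M! can be cancelled.

module Fermat (M : ℕ) (pr : Prime (suc M)) where
  open Congruence (suc M)

  M! : ℕ
  M! = prod {M} val

  ¬∣M! : ¬ suc M ∣ M!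
  ¬∣M! = prod-¬∣ pr val ¬∣val

  fermat : ∀ a → ¬ suc M ∣ a → a ^ M ≡ₘ 1
  fermat a r∤a = *-cancelʳₘ pr ¬∣M! (begin
    a ^ M * M!                   ≡⟨ cong (_* M!) (prod-const {M} a) ⟨
    prod {M} (λ _ → a) * M!      ≡⟨ ∑-distrib-+ {M} (λ _ → a) val ⟨
    prod {M} (λ i → a * val i)   ≈⟨ prod-congₘ times-a-≡ₘ ⟨
    prod (val ∘ times-a)         ≡⟨ prod-reindex val times-a times-a-injective ⟩
    M!                           ≡⟨ *-identityˡ M! ⟨
    1 * M!                       ∎)
    where
    open ≡ₘ-Reasoning
    times-a : Fin M → Fin M
    times-a i = residue (a * val i) (¬∣* pr r∤a (¬∣val i))
    times-a-≡ₘ : ∀ i → val (times-a i) ≡ₘ a * val i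
    times-a-≡ₘ i = residue-≡ₘ (a * val i) (¬∣* pr r∤a (¬∣val i))
    times-a-injective : Injective _≡_ _≡_ times-a
    times-a-injective {i} {j} eq = val-injective (<⇒≡ₘ⇒≡ (s≤s (val≤ i)) (s≤s (val≤ j))
      (*-cancelʳₘ pr r∤a (begin
        val i * a        ≡⟨ *-comm (val i) a ⟩
        a * val i        ≈⟨ times-a-≡ₘ i ⟨
        val (times-a i)  ≡⟨ cong val eq ⟩
        val (times-a j)  ≈⟨ times-a-≡ₘ j ⟩
        a * val j        ≡⟨ *-comm a (val j) ⟩
        val j * a        ∎)))

when unless : ∀ {P : Set} → Dec P → ℕ → ℕ
when   (yes _) x = x
when   (no  _) x = 1
unless (yes _) x = 1
unless (no  _) x = x

-- Split every factor G i according to whether i precedes its partner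
-- ι i; then each 2-cycle {i, ι i} contributes G i · G (ι i) at its
-- smaller point and each fixed point i contributes G i.
module Involution {n} (ι : Fin n → Fin n) (ι-involutive : ∀ i → ι (ι i) ≡ i) where

  ι-injective : Injective _≡_ _≡_ ι
  ι-injective {i} {j} ιi≡ιj = begin
    i        ≡⟨ ι-involutive i ⟨
    ι (ι i)  ≡⟨ cong ι ιi≡ιj ⟩
    ι (ι j)  ≡⟨ ι-involutive j ⟩
    j        ∎
    where open ≡-Reasoning

  pairing : (Fin n → ℕ) → Fin n → ℕ
  pairing G i = when (i FP.≤? ι i) (G i) * unless (ι i FP.≤? i) (G (ι i))

  prod-involution : ∀ G → prod G ≡ prod (pairing G)
  prod-involution G = begin
    prod G                              ≡⟨ sum-cong-≗ front*back ⟨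
    prod (λ i → front i * back i)       ≡⟨ ∑-distrib-+ front back ⟩
    prod front * prod back              ≡⟨ cong (prod front *_) (prod-reindex back ι ι-injective) ⟨
    prod front * prod (back ∘ ι)        ≡⟨ ∑-distrib-+ front (back ∘ ι) ⟨
    prod (λ i → front i * back (ι i))   ≡⟨ sum-cong-≗ (λ i → cong (front i *_) (back∘ι i)) ⟩
    prod (pairing G)                    ∎
    where
    open ≡-Reasoning
    front back : Fin n → ℕ
    front i = when (i FP.≤? ι i) (G i)
    back  i = unless (i FP.≤? ι i) (G i)
    front*back : ∀ i → front i * back i ≡ G i
    front*back i with i FP.≤? ι i
    ... | yes _ = *-identityʳ (G i)
    ... | no  _ = *-identityˡ (G i)
    back∘ι : ∀ i → back (ι i) ≡ unless (ι i FP.≤? i) (G (ι i))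
    back∘ι i = cong (λ k → unless (ι i FP.≤? k) (G (ι i))) (ι-involutive i)

-- Wilson's theorem for the prime r = M + 1 (with M = K + 1):
-- M! ≡ -1.  Inversion modulo r is an involution of {1, …, M} whose only
-- fixed points are 1 and M, so pairing each factor with its inverse
-- leaves only the factor M.

module Wilson (K : ℕ) (pr : Prime (suc (suc K))) where
  private
    M = suc K
    r = suc M
  open Congruence r
  open Fermat M pr

  -- The square roots of 1 modulo r are 1 and M = r - 1, because
  -- (y + 1)² - 1 = y (y + 2).
  square-identity : ∀ y → suc y * suc y ∸ 1 ≡ y * (y + 2)
  square-identity = solve 1 (λ y → y :+ y :* (con 1 :+ y) := y :* (y :+ con 2)) refl
    where open +-*-Solver

  square-roots-of-one : ∀ i → val i * val i ≡ₘ 1 → i ≡ F.zero ⊎ i ≡ last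
  square-roots-of-one i i²≡1 with euclidsLemma (toℕ i) (toℕ i + 2) pr r∣i[i+2]
    where
    r∣i[i+2] : r ∣ toℕ i * (toℕ i + 2)
    r∣i[i+2] = subst (r ∣_) (square-identity (toℕ i)) (≡ₘ⇒∣∸ i²≡1)
  ... | inj₁ r∣i   = inj₁ (FP.toℕ-injective (<⇒≡ₘ⇒≡ (m<n⇒m<1+n (FP.toℕ<n i)) (s≤s z≤n) (∣⇒≡ₘ0 r∣i)))
  ... | inj₂ r∣i+2 = inj₂ (FP.toℕ-injective (trans i≡K (sym (FP.toℕ-fromℕ K))))
    where
    i+2≡r : 2 + toℕ i ≡ r
    i+2≡r = ≤-antisym (s≤s (FP.toℕ<n i)) (∣⇒≤ (subst (r ∣_) (+-comm (toℕ i) 2) r∣i+2))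
    i≡K : toℕ i ≡ K
    i≡K = suc-injective (suc-injective i+2≡r)

  last²≡1 : val (last {K}) * val (last {K}) ≡ₘ 1
  last²≡1 = begin
    val (last {K}) * val (last {K})  ≡⟨ cong (λ v → v * v) (val-last {K}) ⟩
    M * M                            ≈⟨ ∣∸⇒≡ₘ (s≤s z≤n) (subst (r ∣_) (sym (square-identity K)) r∣K[K+2]) ⟩
    1                                ∎
    where
    open ≡ₘ-Reasoning
    r∣K[K+2] : r ∣ K * (K + 2)
    r∣K[K+2] = subst (λ t → r ∣ K * t) (+-comm 2 K) (n∣m*n K)

  -- inverse i = i ^ (M - 1) is the inverse of i modulo r, by Fermat.
  inverse : Fin M → Fin M
  inverse i = residue (val i ^ K) (¬∣^ pr K (¬∣val i))

  inverse-correct : ∀ i → val i * val (inverse i) ≡ₘ 1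
  inverse-correct i = begin
    val i * val (inverse i)   ≈⟨ *-congₘ (≡ₘ-refl {val i}) (residue-≡ₘ (val i ^ K) (¬∣^ pr K (¬∣val i))) ⟩
    val i ^ M                 ≈⟨ fermat (val i) (¬∣val i) ⟩
    1                         ∎
    where open ≡ₘ-Reasoning

  inverse-unique : ∀ i j k → val i * val j ≡ₘ 1 → val i * val k ≡ₘ 1 → j ≡ k
  inverse-unique i j k ij≡1 ik≡1 = val-injective (<⇒≡ₘ⇒≡ (s≤s (val≤ j)) (s≤s (val≤ k))
    (*-cancelʳₘ pr (¬∣val i) (begin
      val j * val i  ≡⟨ *-comm (val j) (val i) ⟩
      val i * val j  ≈⟨ ij≡1 ⟩
      1              ≈⟨ ik≡1 ⟨
      val i * val k  ≡⟨ *-comm (val i) (val k) ⟩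
      val k * val i  ∎)))
    where open ≡ₘ-Reasoning

  inverse-involutive : ∀ i → inverse (inverse i) ≡ i
  inverse-involutive i = inverse-unique (inverse i) (inverse (inverse i)) i (inverse-correct (inverse i))
    (≡ₘ-trans (≡⇒≡ₘ (*-comm (val (inverse i)) (val i))) (inverse-correct i))

  self-inverse : ∀ i → inverse i ≡ i → i ≡ F.zero ⊎ i ≡ last
  self-inverse i ι≡ = square-roots-of-one i (subst (λ k → val i * val k ≡ₘ 1) ι≡ (inverse-correct i))

  last-self-inverse : inverse last ≡ last
  last-self-inverse = inverse-unique last (inverse last) last (inverse-correct last) last²≡1

  open Involution inverse inverse-involutive

  -- After pairing, every factor is ≡ 1 except the one at M.
  onlyLast : Fin M → ℕ
  onlyLast i = when (i FP.≟ last) M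

  -- One factor of the paired product, for i with inverse j: a 2-cycle
  -- contributes i · j ≡ 1 at its smaller point, and the fixed points are
  -- 1 and M.
  pairing-factor : ∀ (i j : Fin M) → val i * val j ≡ₘ 1 → (j ≡ i → i ≡ F.zero ⊎ i ≡ last) → (i ≡ last → j ≡ i) →
    (i≤j? : Dec (i F.≤ j)) (j≤i? : Dec (j F.≤ i)) (i≟last : Dec (i ≡ last)) →
    when i≤j? (val i) * unless j≤i? (val j) ≡ₘ when i≟last M
  pairing-factor i j _  _     _     (yes _)   (yes _)   (yes refl) =
    ≡⇒≡ₘ (trans (*-identityʳ (val (last {K}))) (val-last {K}))
  pairing-factor i j _  fixed _     (yes i≤j) (yes j≤i) (no i≢last) with fixed (FP.≤-antisym j≤i i≤j)
  ... | inj₁ refl   = ≡ₘ-refl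
  ... | inj₂ i≡last = ⊥-elim (i≢last i≡last)
  pairing-factor i j _  _     fixes (yes _)   (no j≰i)  (yes i≡last) = ⊥-elim (j≰i (FP.≤-reflexive (fixes i≡last)))
  pairing-factor i j ij≡1 _   _     (yes _)   (no _)    (no _)       = ij≡1
  pairing-factor i j _  _     fixes (no i≰j)  (yes _)   (yes i≡last) = ⊥-elim (i≰j (FP.≤-reflexive (sym (fixes i≡last))))
  pairing-factor i j _  _     _     (no _)    (yes _)   (no _)       = ≡ₘ-refl
  pairing-factor i j _  _     _     (no i≰j)  (no j≰i)  _            = ⊥-elim ([ i≰j , j≰i ]′ (FP.≤-total i j))

  pairing-val : ∀ i → pairing val i ≡ₘ onlyLast i
  pairing-val i = pairing-factor i (inverse i) (inverse-correct i) (self-inverse i) (λ { refl → last-self-inverse })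
    (i FP.≤? inverse i) (inverse i FP.≤? i) (i FP.≟ last)

  prod-onlyLast : prod onlyLast ≡ M
  prod-onlyLast = begin
    prod onlyLast                                 ≡⟨ sum-init-last onlyLast ⟩
    prod (onlyLast ∘ F.inject₁) * onlyLast last   ≡⟨ cong₂ _*_ (trans (sum-cong-≗ init≡1) (trans (prod-const {K} 1) (^-zeroˡ K))) last≡M ⟩
    1 * M                                         ≡⟨ *-identityˡ M ⟩
    M                                             ∎
    where
    open ≡-Reasoning
    init≡1 : ∀ j → onlyLast (F.inject₁ j) ≡ 1
    init≡1 j with F.inject₁ j FP.≟ last
    ... | yes eq = ⊥-elim (FP.fromℕ≢inject₁ (sym eq))
    ... | no  _  = refl
    last≡M : onlyLast last ≡ M
    last≡M with last {K} FP.≟ last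
    ... | yes _   = refl
    ... | no  neq = ⊥-elim (neq refl)

  wilson : M! ≡ₘ M
  wilson = begin
    M!                   ≡⟨ prod-involution val ⟩
    prod (pairing val)   ≈⟨ prod-congₘ pairing-val ⟩
    prod onlyLast        ≡⟨ prod-onlyLast ⟩
    M                    ∎
    where open ≡ₘ-Reasoning

-- Roots of polynomials modulo a prime

-- A monic polynomial of degree d, c₀ + c₁ x + ⋯ + c_{d-1} x^(d-1) + x^d,
-- given by its lower coefficients and evaluated by Horner's rule.
Monic : ℕ → Set
Monic d = Vec ℕ d

eval : ∀ {d} → Monic d → ℕ → ℕ
eval []       x = 1
eval (c ∷ cs) x = c + x * eval cs x

-- Synthetic division by x - a: a monic quotient and a remainder.
divide : ∀ {d} → Monic (suc d) → ℕ → Monic d × ℕ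
divide (c ∷ [])      a = [] , c + a
divide (c ∷ c′ ∷ cs) a =
  let (Q , ρ) = divide (c′ ∷ cs) a in (ρ ∷ Q) , c + a * ρ

-- P (x) = (x - a) Q (x) + ρ, written without subtraction.
divide-correct : ∀ {d} (P : Monic (suc d)) a x → let (Q , ρ) = divide P a in
  eval P x + a * eval Q x ≡ x * eval Q x + ρ
divide-correct (c ∷ []) a x =
  solve 3 (λ c a x → c :+ x :* con 1 :+ a :* con 1 := x :* con 1 :+ (c :+ a)) refl c a x
  where open +-*-Solver
divide-correct (c ∷ c′ ∷ cs) a x = begin
  c + x * E + a * (ρ + x * G)   ≡⟨ regroup₁ c x E a ρ G ⟩
  c + a * ρ + x * (E + a * G)   ≡⟨ cong (λ t → c + a * ρ + x * t) (divide-correct (c′ ∷ cs) a x) ⟩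
  c + a * ρ + x * (x * G + ρ)   ≡⟨ regroup₂ c a ρ x G ⟩
  x * (ρ + x * G) + (c + a * ρ) ∎
  where
  open ≡-Reasoning
  open +-*-Solver
  E = eval (c′ ∷ cs) x
  G = eval (proj₁ (divide (c′ ∷ cs) a)) x
  ρ = proj₂ (divide (c′ ∷ cs) a)
  regroup₁ : ∀ c x E a ρ G → c + x * E + a * (ρ + x * G) ≡ c + a * ρ + x * (E + a * G)
  regroup₁ = solve 6 (λ c x E a ρ G → c :+ x :* E :+ a :* (ρ :+ x :* G) := c :+ a :* ρ :+ x :* (E :+ a :* G)) refl
  regroup₂ : ∀ c a ρ x G → c + a * ρ + x * (x * G + ρ) ≡ x * (ρ + x * G) + (c + a * ρ)
  regroup₂ = solve 5 (λ c a ρ x G → c :+ a :* ρ :+ x :* (x :* G :+ ρ) := x :* (ρ :+ x :* G) :+ (c :+ a :* ρ)) refl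

xᵏ : ∀ k → Monic k
xᵏ zero    = []
xᵏ (suc k) = 0 ∷ xᵏ k

eval-xᵏ : ∀ k x → eval (xᵏ k) x ≡ x ^ k
eval-xᵏ zero    x = refl
eval-xᵏ (suc k) x = cong (x *_) (eval-xᵏ k x)

module Roots (p : ℕ) .{{_ : NonZero p}} (pr : Prime p) where
  open Congruence p

  -- If P takes the same value at a ≢ b, then b is a root of the
  -- quotient of P by x - a (p has no zero divisors).
  quotient-root : ∀ {d} (P : Monic (suc d)) {a b} → eval P a ≡ₘ eval P b → ¬ a ≡ₘ b →
                  p ∣ eval (proj₁ (divide P a)) b
  quotient-root P {a} {b} Pa≡Pb a≢b =
    *-cancelʳ-≢ₘ pr a≢b (+-cancelˡₘ Pb≡ρ (≡⇒≡ₘ Pb-divided))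
    where
    Q = proj₁ (divide P a)
    ρ = proj₂ (divide P a)
    Pa≡ρ : eval P a ≡ ρ
    Pa≡ρ = +-cancelʳ-≡ (a * eval Q a) (eval P a) ρ (trans (divide-correct P a a) (+-comm (a * eval Q a) ρ))
    Pb≡ρ : eval P b ≡ₘ ρ
    Pb≡ρ = ≡ₘ-trans (≡ₘ-sym Pa≡Pb) (≡⇒≡ₘ Pa≡ρ)
    Pb-divided : eval P b + a * eval Q b ≡ ρ + b * eval Q b
    Pb-divided = trans (divide-correct P a b) (+-comm (b * eval Q b) ρ)

  -- Lagrange: a monic polynomial of degree d has at most d roots modulo
  -- p, since dividing out one root leaves the others as roots.
  at-most-d-roots : ∀ {d} (P : Monic d) (rts : Fin (suc d) → ℕ) → Injective _≡_ _≡ₘ_ rts →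
                    ¬ (∀ i → p ∣ eval P (rts i))
  at-most-d-roots []       rts distinct roots = ¬∣1 pr (roots F.zero)
  at-most-d-roots (c ∷ cs) rts distinct roots =
    at-most-d-roots (proj₁ (divide (c ∷ cs) (rts F.zero))) (rts ∘ F.suc)
      (FP.suc-injective ∘ distinct)
      (λ i → quotient-root (c ∷ cs) (same-value i) (FP.0≢1+n ∘ distinct))
    where
    same-value : ∀ i → eval (c ∷ cs) (rts F.zero) ≡ₘ eval (c ∷ cs) (rts (F.suc i))
    same-value i = ≡ₘ-trans (∣⇒≡ₘ0 (roots F.zero)) (≡ₘ-sym (∣⇒≡ₘ0 (roots (F.suc i))))

  -- Hence x ^ (k + 1) ≡ 1 has at most k + 1 solutions: dividing
  -- x ^ (k + 1) by x - a for one solution a leaves the others as roots of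
  -- the quotient.
  at-most-k-roots-of-unity : ∀ k (rts : Fin (suc (suc k)) → ℕ) → Injective _≡_ _≡ₘ_ rts →
                             ¬ (∀ i → rts i ^ suc k ≡ₘ 1)
  at-most-k-roots-of-unity k rts distinct unity =
    at-most-d-roots (proj₁ (divide (xᵏ (suc k)) (rts F.zero))) (rts ∘ F.suc)
      (FP.suc-injective ∘ distinct)
      (λ i → quotient-root (xᵏ (suc k)) (same-value i) (FP.0≢1+n ∘ distinct))
    where
    value : ∀ i → eval (xᵏ (suc k)) (rts i) ≡ₘ 1
    value i = ≡ₘ-trans (≡⇒≡ₘ (eval-xᵏ (suc k) (rts i))) (unity i)
    same-value : ∀ i → eval (xᵏ (suc k)) (rts F.zero) ≡ₘ eval (xᵏ (suc k)) (rts (F.suc i))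
    same-value i = ≡ₘ-trans (value F.zero) (≡ₘ-sym (value (F.suc i)))

  roots-of-unity-complete : ∀ k (rts : Fin (suc k) → ℕ) → Injective _≡_ _≡ₘ_ rts →
    (∀ j → rts j ^ suc k ≡ₘ 1) → ∀ w → w ^ suc k ≡ₘ 1 → ∃ λ j → w ≡ₘ rts j
  roots-of-unity-complete k rts distinct unity w wᵏ≡1 with FP.any? (λ j → w ≡ₘ? rts j)
  ... | yes found = found
  ... | no  new   = ⊥-elim (at-most-k-roots-of-unity k rts′ distinct′ unity′)
    where
    rts′ : Fin (suc (suc k)) → ℕ
    rts′ F.zero    = w
    rts′ (F.suc j) = rts j
    distinct′ : Injective _≡_ _≡ₘ_ rts′
    distinct′ {F.zero}  {F.zero}  _  = refl
    distinct′ {F.zero}  {F.suc j} eq = ⊥-elim (new (j , eq))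
    distinct′ {F.suc i} {F.zero}  eq = ⊥-elim (new (i , ≡ₘ-sym eq))
    distinct′ {F.suc i} {F.suc j} eq = cong F.suc (distinct eq)
    unity′ : ∀ i → rts′ i ^ suc k ≡ₘ 1
    unity′ F.zero    = wᵏ≡1
    unity′ (F.suc j) = unity j

-- The multiplicative obstruction modulo a prime q

-- There are no injections J, H of {1, …, q - 1} with
-- H i ≡ i · J i · d (mod q) when q ∤ d and q ≥ 3: multiplying over all
-- i gives M! · M! · d ^ (q-1) ≡ M!, so M! ≡ 1 by Fermat, whereas
-- M! ≡ -1 by Wilson.
product-obstruction : ∀ K → Prime (3 + K) → ∀ d → ¬ (3 + K) ∣ d →
  (J H : Fin (2 + K) → Fin (2 + K)) → Injective _≡_ _≡_ J → Injective _≡_ _≡_ H →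
  (∀ i → val (H i) ≡ (val i * val (J i) * d) % (3 + K)) → ⊥
product-obstruction K pr d q∤d J H J-inj H-inj H≡ =
  <⇒≢ (s≤s (s≤s z≤n)) (<⇒≡ₘ⇒≡ (prime≥2 pr) (n<1+n Q) (≡ₘ-trans (≡ₘ-sym M!≡1) wilson))
  where
  Q = 2 + K
  q = 3 + K
  open Congruence q
  open Fermat Q pr
  open Wilson (suc K) pr

  ∏iJ[i]d : prod (λ i → val i * val (J i) * d) ≡ M! * M! * d ^ Q
  ∏iJ[i]d = begin
    prod (λ i → val i * val (J i) * d)          ≡⟨ ∑-distrib-+ (λ i → val i * val (J i)) (λ _ → d) ⟩
    prod (λ i → val i * val (J i)) * prod {Q} (λ _ → d)
      ≡⟨ cong₂ _*_ (∑-distrib-+ val (val ∘ J)) (prod-const {Q} d) ⟩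
    M! * prod (val ∘ J) * d ^ Q                 ≡⟨ cong (λ t → M! * t * d ^ Q) (prod-reindex val J J-inj) ⟩
    M! * M! * d ^ Q                             ∎
    where open ≡-Reasoning

  M!≡1 : M! ≡ₘ 1
  M!≡1 = *-cancelʳₘ pr ¬∣M! (begin
    M! * M!                               ≡⟨ *-identityʳ (M! * M!) ⟨
    M! * M! * 1                           ≈⟨ *-congₘ (≡ₘ-refl {M! * M!}) (fermat d q∤d) ⟨
    M! * M! * d ^ Q                       ≡⟨ ∏iJ[i]d ⟨
    prod (λ i → val i * val (J i) * d)    ≈⟨ prod-congₘ (λ i → ≡ₘ-trans (≡⇒≡ₘ (H≡ i)) (%-≡ₘ (val i * val (J i) * d))) ⟨
    prod (val ∘ H)                        ≡⟨ prod-reindex val H H-inj ⟩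
    M!                                    ≡⟨ *-identityˡ M! ⟨
    1 * M!                                ∎)
    where open ≡ₘ-Reasoning

-- The same holds when q ∣ d, since then i · J i · d ≡ 0.
no-complete-mapping : ∀ Q → Prime (suc Q) → ∀ d → suc Q ∣ d ⊎ 3 ≤ suc Q →
  (J H : Fin Q → Fin Q) → Injective _≡_ _≡_ J → Injective _≡_ _≡_ H →
  (∀ i → val (H i) ≡ (val i * val (J i) * d) % suc Q) → ⊥
no-complete-mapping Q pr d q∣d⊎3≤q J H J-inj H-inj H≡ with suc Q ∣? d | q∣d⊎3≤q
... | no q∤d | inj₁ q∣d                      = q∤d q∣d
... | no q∤d | inj₂ (s≤s (s≤s (s≤s _)))      = product-obstruction _ pr d q∤d J H J-inj H-inj H≡
no-complete-mapping zero    pr _ _ _ _ _ _ _  | yes _   | _ = ⊥-elim (<⇒≱ (prime≥2 pr) (s≤s z≤n))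
no-complete-mapping (suc Q) pr d _ J H _ _ H≡ | yes q∣d | _ =
  1+n≢0 (trans (H≡ F.zero) (n∣m⇒m%n≡0 _ (2 + Q) (∣n⇒∣m*n (val {suc Q} F.zero * val (J F.zero)) q∣d)))

-- Splitting p - 1 at a suitable prime

prime-factor : ∀ n → 2 ≤ n → ∃ λ q → Prime q × q ∣ n
prime-factor n@(suc _) 2≤n with factorise n
... | record { factors = [] ; isFactorisation = n≡1 } = ⊥-elim (<⇒≢ 2≤n (sym n≡1))
... | record { factors = q ∷ _ ; isFactorisation = n≡q*qs ; factorsPrime = q-prime ∷ _ } =
  q , q-prime , subst (q ∣_) (sym n≡q*qs) (m∣m*n _)

-- Every n ≥ 4 is q · d for a prime q with q ≥ 3 or q ∣ d: take an odd
-- prime factor if there is one, otherwise n = 2 d with d even.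
prime-split : ∀ n → 4 ≤ n → ∃₂ λ q d → Prime q × n ≡ q * d × (q ∣ d ⊎ 3 ≤ q)
prime-split n 4≤n with prime-factor n (≤-trans (s≤s (s≤s z≤n)) 4≤n)
... | q , q-prime , divides d n≡dq with q ≟ 2
...   | no q≢2 = q , d , q-prime , trans n≡dq (*-comm d q) , inj₂ (≤∧≢⇒< (prime≥2 q-prime) (q≢2 ∘ sym))
...   | yes refl with 2 ∣? d
...     | yes 2∣d = 2 , d , q-prime , trans n≡dq (*-comm d 2) , inj₁ 2∣d
...     | no  2∤d with prime-factor d (*-cancelʳ-≤ 2 d 2 (subst (4 ≤_) n≡dq 4≤n))
...       | q′ , q′-prime , q′∣d =
  q′ , quotient q′∣n , q′-prime , trans (m∣n⇒n≡quotient*m q′∣n) (*-comm _ q′) ,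
  inj₂ (≤∧≢⇒< (prime≥2 q′-prime) (λ 2≡q′ → 2∤d (subst (_∣ d) (sym 2≡q′) q′∣d)))
  where
  q′∣n : q′ ∣ n
  q′∣n = ∣-trans q′∣d (divides 2 (trans n≡dq (*-comm d 2)))

module Orthomorphism
  (N′ : ℕ) (pr : Prime (2 + N′))
  (σ τ : Fin (suc N′) → Fin (suc N′))
  (σ-surjective : Surjective _≡_ _≡_ σ) (τ-injective : Injective _≡_ _≡_ τ)
  (τ-val : ∀ x → val (τ x) ≡ val x ^ val (σ x) % (2 + N′))
  (Q d : ℕ) (q-prime : Prime (suc Q)) (N≡qd : suc N′ ≡ suc Q * d)
  where

  private
    N = suc N′
    p = suc N
    q = suc Q
  open Congruence p
  open Fermat N pr
  open Roots p pr

  one : Fin N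
  one = F.zero

  -- τ is injective on residues, as its values lie below p.
  τ-injectiveₘ : ∀ {x y} → val (τ x) ≡ₘ val (τ y) → x ≡ y
  τ-injectiveₘ {x} {y} eq = τ-injective (val-injective (<⇒≡ₘ⇒≡ (s≤s (val≤ (τ x))) (s≤s (val≤ (τ y))) eq))

  τ-valₘ : ∀ x → val (τ x) ≡ₘ val x ^ val (σ x)
  τ-valₘ x = ≡ₘ-trans (≡⇒≡ₘ (τ-val x)) (%-≡ₘ (val x ^ val (σ x)))

  -- 1 ^ e = 1, so 1 is the only x with τ x ≡ 1.
  τ≡1⇒one : ∀ x → val (τ x) ≡ₘ 1 → x ≡ one
  τ≡1⇒one x τx≡1 = τ-injectiveₘ (≡ₘ-trans τx≡1 (≡ₘ-sym (≡ₘ-trans (τ-valₘ one) (≡⇒≡ₘ (^-zeroˡ (val (σ one)))))))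

  -- By Fermat x ^ N ≡ 1, so σ x = N only for x = 1; thus σ 1 = N.
  σ≡N⇒one : ∀ x → val (σ x) ≡ N → x ≡ one
  σ≡N⇒one x σx≡N = τ≡1⇒one x (begin
    val (τ x)          ≈⟨ τ-valₘ x ⟩
    val x ^ val (σ x)  ≡⟨ cong (val x ^_) σx≡N ⟩
    val x ^ N          ≈⟨ fermat (val x) (¬∣val x) ⟩
    1                  ∎)
    where open ≡ₘ-Reasoning

  σ⁻¹ : Fin N → Fin N
  σ⁻¹ y = proj₁ (σ-surjective y)

  σ∘σ⁻¹ : ∀ y → σ (σ⁻¹ y) ≡ y
  σ∘σ⁻¹ y = proj₂ (σ-surjective y) refl

  σ-one : val (σ one) ≡ N
  σ-one = subst (λ x → val (σ x) ≡ N) (σ≡N⇒one _ σσ⁻¹N≡N) σσ⁻¹N≡N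
    where σσ⁻¹N≡N : val (σ (σ⁻¹ last)) ≡ N
          σσ⁻¹N≡N = trans (cong val (σ∘σ⁻¹ last)) val-last

  τ^q : ∀ x → val (τ x) ^ q ≡ₘ val x ^ (val (σ x) * q)
  τ^q x = ≡ₘ-trans (^-congₘ q (τ-valₘ x)) (≡⇒≡ₘ (^-*-assoc (val x) (val (σ x)) q))

  instance
    d-nonZero : NonZero d
    d-nonZero = ≢-nonZero λ { refl → 1+n≢0 (trans N≡qd (*-zeroʳ q)) }

  multiple : Fin q → Fin N
  multiple j = fin (val j * d) (*-mono-≤ (1≤val j) (>-nonZero⁻¹ d))
                   (subst (val j * d ≤_) (sym N≡qd) (*-monoˡ-≤ d (val≤ j)))

  y : Fin q → Fin N
  y j = σ⁻¹ (multiple j)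

  σ-y : ∀ j → val (σ (y j)) ≡ val j * d
  σ-y j = trans (cong val (σ∘σ⁻¹ (multiple j))) (val-fin (val j * d) _ _)

  R : Fin q → ℕ
  R j = val (τ (y j))

  σ-y*q : ∀ j → val (σ (y j)) * q ≡ val j * N
  σ-y*q j = begin
    val (σ (y j)) * q  ≡⟨ cong (_* q) (σ-y j) ⟩
    val j * d * q      ≡⟨ *-assoc (val j) d q ⟩
    val j * (d * q)    ≡⟨ cong (val j *_) (trans (*-comm d q) (sym N≡qd)) ⟩
    val j * N          ∎
    where open ≡-Reasoning

  R-root : ∀ j → R j ^ q ≡ₘ 1
  R-root j = begin
    R j ^ q                          ≈⟨ τ^q (y j) ⟩
    val (y j) ^ (val (σ (y j)) * q)  ≡⟨ cong (val (y j) ^_) (σ-y*q j) ⟩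
    val (y j) ^ (val j * N)          ≈⟨ ^-*-≡ₘ1 N (val j) (fermat (val (y j)) (¬∣val (y j))) ⟩
    1                                ∎
    where open ≡ₘ-Reasoning

  R-distinct : Injective _≡_ _≡ₘ_ R
  R-distinct {j} {j′} Rj≡Rj′ = val-injective (*-cancelʳ-≡ (val j) (val j′) d (begin
    val j * d            ≡⟨ σ-y j ⟨
    val (σ (y j))        ≡⟨ cong (val ∘ σ) (τ-injectiveₘ Rj≡Rj′) ⟩
    val (σ (y j′))       ≡⟨ σ-y j′ ⟩
    val j′ * d           ∎))
    where open ≡-Reasoning

  -- ζ = τ (σ⁻¹ d) is ≢ 1: otherwise σ⁻¹ d = 1 and d = σ 1 = N = q d.
  ζ : ℕ
  ζ = R F.zero

  ζ≢1 : ¬ ζ ≡ₘ 1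
  ζ≢1 ζ≡1 = <⇒≢ (prime≥2 q-prime) (sym (*-cancelʳ-≡ q 1 d (begin
    q * d                ≡⟨ N≡qd ⟨
    N                    ≡⟨ σ-one ⟨
    val (σ one)          ≡⟨ cong (val ∘ σ) (τ≡1⇒one (y F.zero) ζ≡1) ⟨
    val (σ (y F.zero))   ≡⟨ σ-y F.zero ⟩
    1 * d                ∎)))
    where open ≡-Reasoning

  p∤ζ : ¬ p ∣ ζ
  p∤ζ = ¬∣val (τ (y F.zero))

  open PrimeOrder pr q-prime p∤ζ (R-root F.zero) ζ≢1

  z : Fin Q → Fin N
  z i = residue (ζ ^ val i) (¬∣^ pr (val i) p∤ζ)

  val-z : ∀ i → val (z i) ≡ₘ ζ ^ val i
  val-z i = residue-≡ₘ (ζ ^ val i) (¬∣^ pr (val i) p∤ζ)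

  z-injective : Injective _≡_ _≡_ z
  z-injective {i} {i′} zi≡zi′ = val-injective (ζ^-injective (s≤s (val≤ i)) (s≤s (val≤ i′))
    (≡ₘ-trans (≡ₘ-sym (val-z i)) (≡ₘ-trans (≡⇒≡ₘ (cong val zi≡zi′)) (val-z i′))))

  z≢one : ∀ i → z i ≢ one
  z≢one i zi≡one = ζ^k≢1 (1≤val i) (s≤s (val≤ i)) (≡ₘ-trans (≡ₘ-sym (val-z i)) (≡⇒≡ₘ (cong val zi≡one)))

  z-root : ∀ i → val (z i) ^ q ≡ₘ 1
  z-root i = begin
    val (z i) ^ q      ≈⟨ ^-congₘ q (val-z i) ⟩
    (ζ ^ val i) ^ q    ≡⟨ ^-*-assoc ζ (val i) q ⟩
    ζ ^ (val i * q)    ≈⟨ ^-*-≡ₘ1 q (val i) (R-root F.zero) ⟩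
    1                  ∎
    where open ≡ₘ-Reasoning

  -- τ (z i) is again a q-th root of unity, hence one of the R j, so z i
  -- is one of the y j.
  τ-z-root : ∀ i → val (τ (z i)) ^ q ≡ₘ 1
  τ-z-root i = ≡ₘ-trans (τ^q (z i)) (^-*-≡ₘ1 q (val (σ (z i))) (z-root i))

  z-is-y : ∀ i → ∃ λ j → z i ≡ y j
  z-is-y i = map₂ τ-injectiveₘ (roots-of-unity-complete Q R R-distinct R-root (val (τ (z i))) (τ-z-root i))

  -- The index j with z i = y j.  It is kept opaque: unfolding it would
  -- run the search for j inside the type checker.
  opaque
    index : Fin Q → Fin q
    index i = proj₁ (z-is-y i)

    z≡y-index : ∀ i → z i ≡ y (index i)
    z≡y-index i = proj₂ (z-is-y i)

  -- Writing z i = y j, the index j is not q, as y q = σ⁻¹ N = 1; so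
  -- J i = j defines an injection of {1, …, q - 1}.
  σ-z-index : ∀ i → val (σ (z i)) ≡ val (index i) * d
  σ-z-index i = trans (cong (val ∘ σ) (z≡y-index i)) (σ-y (index i))

  index≢q : ∀ i → val (index i) ≢ q
  index≢q i j≡q = z≢one i (σ≡N⇒one (z i) (begin
    val (σ (z i))          ≡⟨ σ-z-index i ⟩
    val (index i) * d      ≡⟨ cong (_* d) j≡q ⟩
    q * d                  ≡⟨ N≡qd ⟨
    N                      ∎))
    where open ≡-Reasoning

  index≤Q : ∀ i → val (index i) ≤ Q
  index≤Q i = s≤s⁻¹ (≤∧≢⇒< (val≤ (index i)) (index≢q i))

  J : Fin Q → Fin Q
  J i = fin (val (index i)) (1≤val (index i)) (index≤Q i)

  val-J : ∀ i → val (J i) ≡ val (index i)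
  val-J i = val-fin (val (index i)) (1≤val (index i)) (index≤Q i)

  σ-z : ∀ i → val (σ (z i)) ≡ val (J i) * d
  σ-z i = trans (σ-z-index i) (cong (_* d) (sym (val-J i)))

  J-injective : Injective _≡_ _≡_ J
  J-injective {i} {i′} Ji≡Ji′ = z-injective (begin
    z i              ≡⟨ z≡y-index i ⟩
    y (index i)      ≡⟨ cong y (val-injective (trans (sym (val-J i)) (trans (cong val Ji≡Ji′) (val-J i′)))) ⟩
    y (index i′)     ≡⟨ z≡y-index i′ ⟨
    z i′             ∎)
    where open ≡-Reasoning

  exponent : Fin Q → ℕ
  exponent i = val i * val (J i) * d

  τ-z : ∀ i → val (τ (z i)) ≡ₘ ζ ^ (exponent i % q)
  τ-z i = begin
    val (τ (z i))                 ≈⟨ τ-valₘ (z i) ⟩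
    val (z i) ^ val (σ (z i))     ≡⟨ cong (val (z i) ^_) (σ-z i) ⟩
    val (z i) ^ (val (J i) * d)   ≈⟨ ^-congₘ (val (J i) * d) (val-z i) ⟩
    (ζ ^ val i) ^ (val (J i) * d) ≡⟨ ^-*-assoc ζ (val i) (val (J i) * d) ⟩
    ζ ^ (val i * (val (J i) * d)) ≡⟨ cong (ζ ^_) (*-assoc (val i) (val (J i)) d) ⟨
    ζ ^ exponent i                ≈⟨ ^-%-≡ₘ ζ q (exponent i) (R-root F.zero) ⟩
    ζ ^ (exponent i % q)          ∎
    where open ≡ₘ-Reasoning

  -- The exponent is ≢ 0 mod q since τ (z i) ≢ 1, so H i = exponent i mod q
  -- lies in {1, …, q - 1}; H is injective because τ ∘ z is.
  q∤exponent : ∀ i → ¬ q ∣ exponent i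
  q∤exponent i q∣e = z≢one i (τ≡1⇒one (z i) (≡ₘ-trans (τ-z i) (≡⇒≡ₘ (cong (ζ ^_) (n∣m⇒m%n≡0 _ q q∣e)))))

  H : Fin Q → Fin Q
  H i = residue (exponent i) (q∤exponent i)

  val-H : ∀ i → val (H i) ≡ exponent i % q
  val-H i = val-residue (exponent i) (q∤exponent i)

  H-injective : Injective _≡_ _≡_ H
  H-injective {i} {i′} Hi≡Hi′ = z-injective (τ-injectiveₘ (begin
    val (τ (z i))          ≈⟨ τ-z i ⟩
    ζ ^ (exponent i % q)   ≡⟨ cong (ζ ^_) (trans (sym (val-H i)) (trans (cong val Hi≡Hi′) (val-H i′))) ⟩
    ζ ^ (exponent i′ % q)  ≈⟨ τ-z i′ ⟨
    val (τ (z i′))         ∎))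
    where open ≡ₘ-Reasoning

  impossible : q ∣ d ⊎ 3 ≤ q → ⊥
  impossible q∣d⊎3≤q = no-complete-mapping Q q-prime d q∣d⊎3≤q J H J-injective H-injective val-H

no-exp-orthomorphism : ∀ N′ → Prime (2 + N′) → 4 ≤ suc N′ → ExpOrthomorphism (2 + N′) → ⊥
no-exp-orthomorphism N′ pr 4≤N (σ , (_ , σ-surjective) , τ , (τ-injective , _) , τ≡) =
  from-split (prime-split (suc N′) 4≤N)
  where
  τ-val : ∀ x → val (τ x) ≡ val x ^ val (σ x) % (2 + N′)
  τ-val x = begin
    val (τ x)                                         ≡⟨ val≡elt (τ x) ⟩
    elt {2 + N′} (τ x)                                ≡⟨ τ≡ x ⟩
    elt {2 + N′} x ^ elt {2 + N′} (σ x) % (2 + N′)    ≡⟨ cong₂ (λ a b → a ^ b % (2 + N′)) (val≡elt x) (val≡elt (σ x)) ⟨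
    val x ^ val (σ x) % (2 + N′)                      ∎
    where open ≡-Reasoning
  from-split : (∃₂ λ q d → Prime q × suc N′ ≡ q * d × (q ∣ d ⊎ 3 ≤ q)) → ⊥
  from-split (zero  , _ , q-prime , _) = <⇒≱ (prime≥2 q-prime) z≤n
  from-split (suc Q , d , q-prime , N≡qd , q∣d⊎3≤q) =
    Orthomorphism.impossible N′ pr σ τ σ-surjective τ-injective τ-val Q d q-prime N≡qd q∣d⊎3≤q

proposition3p3 : (n : ℕ) .{{_ : NonZero n}} → 3 ≤ n → Prime n → ExpOrthomorphism n → n ≡ 3
proposition3p3 2 (s≤s (s≤s ())) _ _
proposition3p3 3 _ _ _ = refl
proposition3p3 4 _ 4-prime _ = ⊥-elim (prime⇒¬composite 4-prime composite[4])
proposition3p3 (suc (suc (suc (suc (suc k))))) _ p-prime orth =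
  ⊥-elim (no-exp-orthomorphism (3 + k) p-prime (s≤s (s≤s (s≤s (s≤s z≤n)))) orth)
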